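{- Let $\mathcal{C}$ and $\mathcal{C}'$ be binary linear codes of lengths $n,n'\ge 3$ such that $0\cdots01$ is a codeword of neither $\mathcal{C}$ nor $\mathcal{C}^\perp$, and $10\cdots0$ is a codeword of neither $\mathcal{C}'$ nor $\mathcal{C}'^\perp$. Then (a) $\dim(\mathcal{C}\oplus_2\mathcal{C}')=\dim(\mathcal{C})+\dim(\mathcal{C}')-1$; (b) $d(\mathcal{C}\oplus_2\mathcal{C}')\le\min\{d(\mathcal{C}\setminus\{n\}),\ d(\mathcal{C}'\setminus\{1\})\}$.
   Context: $\mathcal{C}\oplus_2\mathcal{C}'=\{(c_1,\dots,c_{n-1},c'_2,\dots,c'_{n'}) : c\in\mathcal{C},\ c'\in\mathcal{C}',\ c_n=c'_1\}$ (the 2-sum). For a code $\mathcal{D}$ and a set $J$ of coordinates, $\mathcal{D}\setminus J$ denotes the code obtained by shortening $\mathcal{D}$ at $J$: take the codewords of $\mathcal{D}$ that are zero on $J$ and delete the coordinates in $J$. $d(\cdot)$ denotes minimum Hamming distance. -}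

module Defs where

open import Data.Bool using (Bool; true; false; _xor_; _∧_)
open import Data.Nat using (ℕ; zero; suc; _+_; _≤_)
open import Data.Vec using (Vec; []; _∷_; replicate; zipWith; init; last; head; tail; _++_; _∷ʳ_)
open import Data.Product using (Σ; ∃; _×_; _,_)
open import Relation.Binary.PropositionalEquality using (_≡_; _≢_)

-- Binary words of length n (elements of F₂ⁿ; Bool with xor/∧ is F₂).
Word : ℕ → Set
Word n = Vec Bool n

zeros : ∀ {n} → Word n
zeros = replicate _ false

_⊕_ : ∀ {n} → Word n → Word n → Word n
_⊕_ = zipWith _xor_

Code : ℕ → Set₁
Code n = Word n → Set

-- Binary linear code: an F₂-subspace (contains 0, closed under addition;
-- over F₂ closure under scalar multiplication is then automatic).
record IsLinear {n : ℕ} (C : Code n) : Set where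
  field
    has-zero : C zeros
    closed-⊕ : ∀ x y → C x → C y → C (x ⊕ y)

dot : ∀ {n} → Word n → Word n → Bool
dot [] [] = false
dot (x ∷ xs) (y ∷ ys) = (x ∧ y) xor dot xs ys

_⊥ : ∀ {n} → Code n → Code n
(C ⊥) y = ∀ x → C x → dot x y ≡ false

lincomb : ∀ {n k} → Vec Bool k → Vec (Word n) k → Word n
lincomb [] [] = zeros
lincomb (false ∷ as) (v ∷ vs) = lincomb as vs
lincomb (true ∷ as) (v ∷ vs) = v ⊕ lincomb as vs

data AllIn {n : ℕ} (C : Code n) : ∀ {k} → Vec (Word n) k → Set where
  []  : AllIn C []
  _∷_ : ∀ {k v} {vs : Vec (Word n) k} → C v → AllIn C vs → AllIn C (v ∷ vs)

record IsBasis {n k : ℕ} (C : Code n) (B : Vec (Word n) k) : Set where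
  field
    members     : AllIn C B
    independent : ∀ a → lincomb a B ≡ zeros → a ≡ replicate k false
    spanning    : ∀ x → C x → Σ (Vec Bool k) λ a → lincomb a B ≡ x

HasDim : ∀ {n} → Code n → ℕ → Set
HasDim {n} C k = Σ (Vec (Word n) k) λ B → IsBasis C B

wt : ∀ {n} → Word n → ℕ
wt [] = 0
wt (false ∷ xs) = wt xs
wt (true ∷ xs) = suc (wt xs)

-- d(C) = d : d is the minimum weight of a nonzero codeword.
-- (For a code with no nonzero codeword no such d exists, i.e. d = ∞.)
IsMinDist : ∀ {n} → Code n → ℕ → Set
IsMinDist {n} C d =
  (Σ (Word n) λ x → C x × x ≢ zeros × wt x ≡ d) ×
  (∀ x → C x → x ≢ zeros → d ≤ wt x)

twoSum : ∀ {m m'} → Code (suc m) → Code (suc m') → Code (m + m')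
twoSum {m} {m'} C C' x =
  Σ (Word (suc m)) λ c → Σ (Word (suc m')) λ c' →
    C c × C' c' × last c ≡ head c' × x ≡ init c ++ tail c'

shortenLast : ∀ {m} → Code (suc m) → Code m
shortenLast {m} C x = Σ (Word (suc m)) λ c → C c × last c ≡ false × init c ≡ x

shortenFirst : ∀ {m} → Code (suc m) → Code m
shortenFirst {m} C x = Σ (Word (suc m)) λ c → C c × head c ≡ false × tail c ≡ x

e-last : ∀ {m} → Word (suc m)
e-last = replicate _ false ∷ʳ true

e-first : ∀ {m} → Word (suc m)
e-first = true ∷ replicate _ false

-- (a) Bases identify C and C' with F₂ᵏ and F₂ᵏ', hence C ⊞ C' (words c ++ c') with
-- F₂ᵏ⁺ᵏ'. The glued words, those with last c = head c', form the kernel of the seam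
-- form last c + head c', which is nonzero on C ⊞ C' because e-last ∉ C⊥; so they
-- form a space of dimension k + k' - 1. Deleting the two seam coordinates maps it
-- onto the 2-sum, injectively: a glued word is sent to 0 only if c ∈ {0, e-last},
-- and e-last ∉ C forces c = 0, then c' = 0.
-- (b) Padding with zeros embeds each shortened code weight-preservingly into the
-- 2-sum.

module Submission where

open import Defs
open import Algebra.Bundles using (CommutativeRing)
open import Data.Bool using (Bool; true; false; _xor_; _∧_)
open import Data.Bool.Properties
  using (xor-same; xor-assoc; xor-comm; xor-identityˡ; xor-identityʳ; ∧-identityʳ; ∧-zeroʳ; xor-∧-commutativeRing)
open import Algebra.Properties.CommutativeSemigroup (CommutativeRing.+-commutativeSemigroup xor-∧-commutativeRing)
  using () renaming (interchange to xor-interchange)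
open import Data.Empty using (⊥-elim)
open import Data.Nat using (ℕ; zero; suc; _+_; _∸_; _≤_)
open import Data.Nat.Properties using (+-identityʳ)
open import Data.Product using (∃; _×_; _,_; proj₁; proj₂)
open import Data.Sum as Sum using (_⊎_; inj₁; inj₂)
open import Data.Vec using (Vec; []; _∷_; map; init; last; head; tail; take; drop; _++_)
open import Data.Vec.Properties
  using (zipWith-assoc; zipWith-comm; zipWith-identityˡ; zipWith-++; take-zipWith; drop-zipWith;
         take++drop≡id; ++-injectiveˡ; ++-injectiveʳ; ++-injective)
open import Function using (_∘_)
open import Relation.Nullary using (¬_)
open import Relation.Binary.PropositionalEquality

private
  variable
    k k' n n' N : ℕ

xor≡false⇒≡ : ∀ a b → a xor b ≡ false → a ≡ b
xor≡false⇒≡ true  true  _ = refl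
xor≡false⇒≡ false false _ = refl

⊕-identityˡ : (x : Word n) → zeros ⊕ x ≡ x
⊕-identityˡ = zipWith-identityˡ xor-identityˡ

⊕-assoc : (x y z : Word n) → (x ⊕ y) ⊕ z ≡ x ⊕ (y ⊕ z)
⊕-assoc = zipWith-assoc xor-assoc

⊕-comm : (x y : Word n) → x ⊕ y ≡ y ⊕ x
⊕-comm = zipWith-comm xor-comm

⊕-self : (x : Word n) → x ⊕ x ≡ zeros
⊕-self []      = refl
⊕-self (a ∷ x) = cong₂ _∷_ (xor-same a) (⊕-self x)

⊕-interchange : (x y z w : Word n) → (x ⊕ y) ⊕ (z ⊕ w) ≡ (x ⊕ z) ⊕ (y ⊕ w)
⊕-interchange []      []      []      []      = refl
⊕-interchange (a ∷ x) (b ∷ y) (c ∷ z) (d ∷ w) =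
  cong₂ _∷_ (xor-interchange a b c d) (⊕-interchange x y z w)

zeros-++ : ∀ n {n'} → zeros {n} ++ zeros {n'} ≡ zeros
zeros-++ zero    = refl
zeros-++ (suc n) = cong (false ∷_) (zeros-++ n)

take-++ : (x : Word n) (y : Word n') → take n (x ++ y) ≡ x
take-++ {n} x y = ++-injectiveˡ _ x (take++drop≡id n (x ++ y))

drop-++ : (x : Word n) (y : Word n') → drop n (x ++ y) ≡ y
drop-++ {n} x y = ++-injectiveʳ _ x (take++drop≡id n (x ++ y))

init-⊕ : (x y : Word (suc n)) → init (x ⊕ y) ≡ init x ⊕ init y
init-⊕ {zero}  (a ∷ []) (b ∷ []) = refl
init-⊕ {suc n} (a ∷ x)  (b ∷ y)  = cong ((a xor b) ∷_) (init-⊕ x y)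

last-⊕ : (x y : Word (suc n)) → last (x ⊕ y) ≡ last x xor last y
last-⊕ {zero}  (a ∷ []) (b ∷ []) = refl
last-⊕ {suc n} (a ∷ x)  (b ∷ y)  = last-⊕ x y

head-⊕ : (x y : Word (suc n)) → head (x ⊕ y) ≡ head x xor head y
head-⊕ (a ∷ x) (b ∷ y) = refl

tail-⊕ : (x y : Word (suc n)) → tail (x ⊕ y) ≡ tail x ⊕ tail y
tail-⊕ (a ∷ x) (b ∷ y) = refl

last-zeros : last (zeros {suc n}) ≡ false
last-zeros {zero}  = refl
last-zeros {suc n} = last-zeros {n}

init-zeros : init (zeros {suc n}) ≡ zeros
init-zeros {zero}  = refl
init-zeros {suc n} = cong (false ∷_) (init-zeros {n})

init≡zeros⇒ : (c : Word (suc n)) → init c ≡ zeros → c ≡ zeros ⊎ c ≡ e-last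
init≡zeros⇒ {zero}  (false ∷ []) _ = inj₁ refl
init≡zeros⇒ {zero}  (true  ∷ []) _ = inj₂ refl
init≡zeros⇒ {suc n} (a ∷ c)      e =
  Sum.map (cong₂ _∷_ (cong head e)) (cong₂ _∷_ (cong head e)) (init≡zeros⇒ c (cong tail e))

dot-e-last : (x : Word (suc n)) → dot x e-last ≡ last x
dot-e-last {zero}  (a ∷ [])    = trans (xor-identityʳ _) (∧-identityʳ a)
dot-e-last {suc n} (a ∷ b ∷ x) =
  trans (cong (_xor dot (b ∷ x) e-last) (∧-zeroʳ a)) (dot-e-last (b ∷ x))

wt-++ : (x : Word n) (y : Word n') → wt (x ++ y) ≡ wt x + wt y
wt-++ []          y = refl
wt-++ (true  ∷ x) y = cong suc (wt-++ x y)
wt-++ (false ∷ x) y = wt-++ x y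

wt-zeros : wt (zeros {n}) ≡ 0
wt-zeros {zero}  = refl
wt-zeros {suc n} = wt-zeros {n}

allFalse⊎anyTrue : (f : Word n → Bool) → (∀ x → f x ≡ false) ⊎ ∃ λ x → f x ≡ true
allFalse⊎anyTrue {zero} f with f [] in e
... | true  = inj₂ ([] , e)
... | false = inj₁ λ { [] → e }
allFalse⊎anyTrue {suc n} f
  with allFalse⊎anyTrue (f ∘ (false ∷_)) | allFalse⊎anyTrue (f ∘ (true ∷_))
... | inj₂ (x , e) | _            = inj₂ (false ∷ x , e)
... | inj₁ _       | inj₂ (x , e) = inj₂ (true ∷ x , e)
... | inj₁ f₀      | inj₁ f₁      = inj₁ λ { (false ∷ x) → f₀ x ; (true ∷ x) → f₁ x }

IsLinearMap : (Word k → Word n) → Set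
IsLinearMap L = ∀ x y → L (x ⊕ y) ≡ L x ⊕ L y

IsLinearForm : (Word n → Bool) → Set
IsLinearForm φ = ∀ x y → φ (x ⊕ y) ≡ φ x xor φ y

linearMap-zeros : (L : Word k → Word n) → IsLinearMap L → L zeros ≡ zeros
linearMap-zeros L lin = begin
  L zeros           ≡⟨ cong L (⊕-self zeros) ⟨
  L (zeros ⊕ zeros) ≡⟨ lin zeros zeros ⟩
  L zeros ⊕ L zeros ≡⟨ ⊕-self (L zeros) ⟩
  zeros             ∎
  where open ≡-Reasoning

linearForm-zeros : (φ : Word n → Bool) → IsLinearForm φ → φ zeros ≡ false
linearForm-zeros φ lin =
  trans (cong φ (sym (⊕-self zeros))) (trans (lin zeros zeros) (xor-same (φ zeros)))

Ker : (Word n → Bool) → Code n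
Ker φ x = φ x ≡ false

_∩_ : Code n → Code n → Code n
(A ∩ B) x = A x × B x

record LinearIso (L : Word k → Word n) (C : Code n) : Set where
  field
    linear         : IsLinearMap L
    trivial-kernel : ∀ x → L x ≡ zeros → x ≡ zeros
    into           : ∀ x → C (L x)
    onto           : ∀ y → C y → ∃ λ x → L x ≡ y

∘-linearIso : {M : Word k → Word N} {L : Word N → Word n} {A : Code N} {B : Code n} →
              LinearIso M A → IsLinearMap L →
              (∀ x → A x → L x ≡ zeros → x ≡ zeros) →
              (∀ x → A x → B (L x)) →
              (∀ y → B y → ∃ λ x → A x × L x ≡ y) →
              LinearIso (L ∘ M) B
∘-linearIso {M = M} {L} isoM L-linear L-injective L-into L-onto = record
  { linear         = λ x y → trans (cong L (linear x y)) (L-linear (M x) (M y))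
  ; trivial-kernel = λ x e → trivial-kernel x (L-injective (M x) (into x) e)
  ; into           = λ x → L-into (M x) (into x)
  ; onto           = λ y b → let (x , a , Lx≡y) = L-onto y b
                                 (z , Mz≡x)     = onto x a
                             in z , trans (cong L Mz≡x) Lx≡y
  }
  where open LinearIso isoM

nonzeroOn⇒image-witness : {L : Word k → Word n} {A : Code n} (φ : Word n → Bool) →
                          LinearIso L A → ¬ (∀ x → A x → φ x ≡ false) →
                          ∃ λ a → φ (L a) ≡ true
nonzeroOn⇒image-witness {L = L} φ isoL φ≢0 with allFalse⊎anyTrue (φ ∘ L)
... | inj₂ witness = witness
... | inj₁ φL≡0    = ⊥-elim (φ≢0 λ x Ax → let (a , La≡x) = LinearIso.onto isoL x Ax
                                            in trans (cong φ (sym La≡x)) (φL≡0 a))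

lincomb-⊕ : (vs : Vec (Word n) k) (a b : Word k) →
            lincomb (a ⊕ b) vs ≡ lincomb a vs ⊕ lincomb b vs
lincomb-⊕ []       []          []          = sym (⊕-self zeros)
lincomb-⊕ (v ∷ vs) (false ∷ a) (false ∷ b) = lincomb-⊕ vs a b
lincomb-⊕ (v ∷ vs) (true  ∷ a) (false ∷ b) =
  trans (cong (v ⊕_) (lincomb-⊕ vs a b)) (sym (⊕-assoc v _ _))
lincomb-⊕ (v ∷ vs) (false ∷ a) (true  ∷ b) = begin
  v ⊕ lincomb (a ⊕ b) vs ≡⟨ cong (v ⊕_) (lincomb-⊕ vs a b) ⟩
  v ⊕ (A ⊕ B)            ≡⟨ ⊕-assoc v A B ⟨
  (v ⊕ A) ⊕ B            ≡⟨ cong (_⊕ B) (⊕-comm v A) ⟩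
  (A ⊕ v) ⊕ B            ≡⟨ ⊕-assoc A v B ⟩
  A ⊕ (v ⊕ B)            ∎
  where open ≡-Reasoning
        A = lincomb a vs
        B = lincomb b vs
lincomb-⊕ (v ∷ vs) (true  ∷ a) (true  ∷ b) = begin
  lincomb (a ⊕ b) vs          ≡⟨ lincomb-⊕ vs a b ⟩
  A ⊕ B                       ≡⟨ ⊕-identityˡ (A ⊕ B) ⟨
  zeros ⊕ (A ⊕ B)             ≡⟨ cong (_⊕ (A ⊕ B)) (⊕-self v) ⟨
  (v ⊕ v) ⊕ (A ⊕ B)           ≡⟨ ⊕-interchange v v A B ⟩
  (v ⊕ A) ⊕ (v ⊕ B)           ∎
  where open ≡-Reasoning
        A = lincomb a vs
        B = lincomb b vs

lincomb-∈ : {C : Code n} → IsLinear C → {vs : Vec (Word n) k} → AllIn C vs → ∀ a → C (lincomb a vs)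
lincomb-∈ linC []         []          = IsLinear.has-zero linC
lincomb-∈ linC (_ ∷ vs∈C) (false ∷ a) = lincomb-∈ linC vs∈C a
lincomb-∈ linC (v∈C ∷ vs∈C) (true ∷ a) = IsLinear.closed-⊕ linC _ _ v∈C (lincomb-∈ linC vs∈C a)

hasDim⇒linearIso : {C : Code n} → IsLinear C → HasDim C k → ∃ λ (L : Word k → Word n) → LinearIso L C
hasDim⇒linearIso linC (B , basis) = (λ a → lincomb a B) , record
  { linear         = lincomb-⊕ B
  ; trivial-kernel = independent
  ; into           = lincomb-∈ linC members
  ; onto           = spanning
  }
  where open IsBasis basis

lincomb-map : (L : Word n → Word n') → IsLinearMap L → (a : Word k) (vs : Vec (Word n) k) →
              lincomb a (map L vs) ≡ L (lincomb a vs)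
lincomb-map L lin []          []       = sym (linearMap-zeros L lin)
lincomb-map L lin (false ∷ a) (v ∷ vs) = lincomb-map L lin a vs
lincomb-map L lin (true  ∷ a) (v ∷ vs) = trans (cong (L v ⊕_) (lincomb-map L lin a vs)) (sym (lin v _))

unitVectors : ∀ k → Vec (Word k) k
unitVectors zero    = []
unitVectors (suc k) = (true ∷ zeros) ∷ map (false ∷_) (unitVectors k)

lincomb-unitVectors : (a : Word k) → lincomb a (unitVectors k) ≡ a
lincomb-unitVectors []          = refl
lincomb-unitVectors (false ∷ a) =
  trans (lincomb-map (false ∷_) (λ _ _ → refl) a _) (cong (false ∷_) (lincomb-unitVectors a))
lincomb-unitVectors (true ∷ a)  =
  trans (cong ((true ∷ zeros) ⊕_) (lincomb-map (false ∷_) (λ _ _ → refl) a _))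
        (cong (true ∷_) (trans (⊕-identityˡ _) (lincomb-unitVectors a)))

AllIn-map : {C : Code n} (L : Word k → Word n) → (∀ x → C (L x)) → (vs : Vec (Word k) N) → AllIn C (map L vs)
AllIn-map L L∈C []       = []
AllIn-map L L∈C (v ∷ vs) = L∈C v ∷ AllIn-map L L∈C vs

linearIso⇒hasDim : {L : Word k → Word n} {C : Code n} → LinearIso L C → HasDim C k
linearIso⇒hasDim {k} {L = L} isoL = map L (unitVectors k) , record
  { members     = AllIn-map L into (unitVectors k)
  ; independent = λ a e → trivial-kernel a (trans (sym (lincomb-image a)) e)
  ; spanning    = λ y y∈C → let (a , La≡y) = onto y y∈C in a , trans (lincomb-image a) La≡y
  }
  where
    open LinearIso isoL
    lincomb-image : ∀ a → lincomb a (map L (unitVectors k)) ≡ L a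
    lincomb-image a = trans (lincomb-map L linear a _) (cong L (lincomb-unitVectors a))

-- Either φ e₁ = 1 and Ker φ is the graph of y ↦ φ (0 ∷ y), or φ ignores the first
-- coordinate and the kernel is found recursively on the remaining ones.
module _ (φ : Word (suc N) → Bool) (φ-linear : IsLinearForm φ) where

  private
    φ₀ : Word N → Bool
    φ₀ y = φ (false ∷ y)

  form-∷ : ∀ h y → φ (h ∷ y) ≡ (h ∧ φ (true ∷ zeros)) xor φ (false ∷ y)
  form-∷ h y = begin
    φ (h ∷ y)                              ≡⟨ cong φ (cong₂ _∷_ (xor-identityʳ h) (⊕-identityˡ y)) ⟨
    φ ((h ∷ zeros) ⊕ (false ∷ y))          ≡⟨ φ-linear (h ∷ zeros) (false ∷ y) ⟩
    φ (h ∷ zeros) xor φ (false ∷ y)        ≡⟨ cong (_xor φ₀ y) (φ-on-axis h) ⟩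
    (h ∧ φ (true ∷ zeros)) xor φ (false ∷ y) ∎
    where
      open ≡-Reasoning
      φ-on-axis : ∀ h → φ (h ∷ zeros) ≡ h ∧ φ (true ∷ zeros)
      φ-on-axis true  = refl
      φ-on-axis false = linearForm-zeros φ φ-linear

  Ker-pivot : φ (true ∷ zeros) ≡ true → LinearIso (λ y → φ₀ y ∷ y) (Ker φ)
  Ker-pivot pivot = record
    { linear         = λ x y → cong (_∷ (x ⊕ y)) (φ-linear (false ∷ x) (false ∷ y))
    ; trivial-kernel = λ y → cong tail
    ; into           = λ y → trans (φ-pivot (φ₀ y) y) (xor-same (φ₀ y))
    ; onto           = λ { (h ∷ y) φ≡0 →
                         y , cong (_∷ y) (sym (xor≡false⇒≡ h (φ₀ y) (trans (sym (φ-pivot h y)) φ≡0))) }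
    }
    where
      φ-pivot : ∀ h y → φ (h ∷ y) ≡ h xor φ₀ y
      φ-pivot h y = trans (form-∷ h y) (cong (_xor φ₀ y) (trans (cong (h ∧_) pivot) (∧-identityʳ h)))

  φ-flat : φ (true ∷ zeros) ≡ false → ∀ h y → φ (h ∷ y) ≡ φ₀ y
  φ-flat pivot h y = trans (form-∷ h y) (cong (_xor φ₀ y) (trans (cong (h ∧_) pivot) (∧-zeroʳ h)))

onTail : (Word k → Word n) → Word (suc k) → Word (suc n)
onTail M (h ∷ x) = h ∷ M x

Ker-shift : (φ : Word (suc N) → Bool) (φ-linear : IsLinearForm φ) → φ (true ∷ zeros) ≡ false →
            {M : Word k → Word N} → LinearIso M (Ker (φ ∘ (false ∷_))) → LinearIso (onTail M) (Ker φ)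
Ker-shift φ φ-linear pivot {M} isoM = record
  { linear         = λ { (a ∷ x) (b ∷ y) → cong ((a xor b) ∷_) (linear x y) }
  ; trivial-kernel = λ { (h ∷ x) e → cong₂ _∷_ (cong head e) (trivial-kernel x (cong tail e)) }
  ; into           = λ { (h ∷ x) → trans (φ-flat φ φ-linear pivot h (M x)) (into x) }
  ; onto           = λ { (h ∷ y) φ≡0 →
                         let (x , Mx≡y) = onto y (trans (sym (φ-flat φ φ-linear pivot h y)) φ≡0)
                         in h ∷ x , cong (h ∷_) Mx≡y }
  }
  where open LinearIso isoM

Ker-linearIso-suc : (φ : Word (suc N) → Bool) → IsLinearForm φ → ∃ (λ w → φ w ≡ true) →
                    ∃ λ (M : Word N → Word (suc N)) → LinearIso M (Ker φ)
Ker-linearIso-suc φ φ-linear w with φ (true ∷ zeros) in pivot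
... | true = _ , Ker-pivot φ φ-linear pivot
Ker-linearIso-suc {zero} φ φ-linear (h ∷ [] , φw) | false
  with trans (sym φw) (trans (φ-flat φ φ-linear pivot h []) (linearForm-zeros φ φ-linear))
... | ()
Ker-linearIso-suc {suc N} φ φ-linear (h ∷ y , φw) | false =
  let (M , isoM) = Ker-linearIso-suc (φ ∘ (false ∷_)) (λ x z → φ-linear (false ∷ x) (false ∷ z))
                                     (y , trans (sym (φ-flat φ φ-linear pivot h y)) φw)
  in onTail M , Ker-shift φ φ-linear pivot isoM

Ker-linearIso : (φ : Word N → Bool) → IsLinearForm φ → ∃ (λ w → φ w ≡ true) →
                ∃ λ (M : Word (N ∸ 1) → Word N) → LinearIso M (Ker φ)
Ker-linearIso {zero} φ φ-linear ([] , φw) with trans (sym φw) (linearForm-zeros φ φ-linear)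
... | ()
Ker-linearIso {suc N} = Ker-linearIso-suc

∩Ker-linearIso : {L : Word k → Word n} {A : Code n} (φ : Word n → Bool) → IsLinearForm φ →
                 LinearIso L A → ∃ (λ a → φ (L a) ≡ true) →
                 ∃ λ (M : Word (k ∸ 1) → Word n) → LinearIso M (A ∩ Ker φ)
∩Ker-linearIso {L = L} {A} φ φ-linear isoL w =
  let (K , isoK) = Ker-linearIso (φ ∘ L) φL-linear w
  in L ∘ K , ∘-linearIso isoK linear (λ x _ → trivial-kernel x) (λ x φLx≡0 → into x , φLx≡0) preimage
  where
    open LinearIso isoL
    φL-linear : IsLinearForm (φ ∘ L)
    φL-linear x y = trans (cong φ (linear x y)) (φ-linear (L x) (L y))
    preimage : ∀ y → (A ∩ Ker φ) y → ∃ λ x → Ker (φ ∘ L) x × L x ≡ y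
    preimage y (Ay , φy≡0) = let (x , Lx≡y) = onto y Ay in x , trans (cong φ Lx≡y) φy≡0 , Lx≡y

_⊞_ : Code n → Code n' → Code (n + n')
_⊞_ {n} C C' z = C (take n z) × C' (drop n z)

_⊞ᴸ_ : (Word k → Word n) → (Word k' → Word n') → Word (k + k') → Word (n + n')
_⊞ᴸ_ {k} L L' x = L (take k x) ++ L' (drop k x)

⊞ᴸ-++ : (L : Word k → Word n) (L' : Word k' → Word n') (a : Word k) (a' : Word k') →
        (L ⊞ᴸ L') (a ++ a') ≡ L a ++ L' a'
⊞ᴸ-++ L L' a a' = cong₂ (λ u v → L u ++ L' v) (take-++ a a') (drop-++ a a')

⊞-linearIso : {L : Word k → Word n} {L' : Word k' → Word n'} {C : Code n} {C' : Code n'} →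
              LinearIso L C → LinearIso L' C' → LinearIso (L ⊞ᴸ L') (C ⊞ C')
⊞-linearIso {k} {n = n} {L = L} {L'} {C} {C'} isoL isoL' = record
  { linear         = linear⊞
  ; trivial-kernel = trivial-kernel⊞
  ; into           = λ x → subst C (sym (take-++ (L (take k x)) _)) (into (take k x))
                         , subst C' (sym (drop-++ (L (take k x)) _)) (into' (drop k x))
  ; onto           = λ z (c , c') → let (a , La≡) = onto _ c ; (a' , L'a'≡) = onto' _ c'
                                    in a ++ a' , trans (⊞ᴸ-++ L L' a a')
                                                       (trans (cong₂ _++_ La≡ L'a'≡) (take++drop≡id n z))
  }
  where
    open LinearIso isoL
    open LinearIso isoL' renaming (linear to linear'; trivial-kernel to trivial-kernel'; into to into'; onto to onto')
    linear⊞ : IsLinearMap (L ⊞ᴸ L')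
    linear⊞ x y = begin
      L (take k (x ⊕ y)) ++ L' (drop k (x ⊕ y))
        ≡⟨ cong₂ (λ u v → L u ++ L' v) (take-zipWith {m = k} _xor_ x y) (drop-zipWith {m = k} _xor_ x y) ⟩
      L (take k x ⊕ take k y) ++ L' (drop k x ⊕ drop k y)
        ≡⟨ cong₂ _++_ (linear _ _) (linear' _ _) ⟩
      (L (take k x) ⊕ L (take k y)) ++ (L' (drop k x) ⊕ L' (drop k y))
        ≡⟨ zipWith-++ _xor_ (L (take k x)) (L' (drop k x)) (L (take k y)) (L' (drop k y)) ⟨
      (L ⊞ᴸ L') x ⊕ (L ⊞ᴸ L') y
        ∎
      where open ≡-Reasoning
    trivial-kernel⊞ : ∀ x → (L ⊞ᴸ L') x ≡ zeros → x ≡ zeros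
    trivial-kernel⊞ x e =
      let (La≡0 , L'a'≡0) = ++-injective (L (take k x)) zeros (trans e (sym (zeros-++ n)))
      in trans (sym (take++drop≡id k x))
               (trans (cong₂ _++_ (trivial-kernel _ La≡0) (trivial-kernel' _ L'a'≡0)) (zeros-++ k))

seam : ∀ m {m'} → Word (suc m + suc m') → Bool
seam m z = last (take (suc m) z) xor head (drop (suc m) z)

deleteSeam : ∀ m {m'} → Word (suc m + suc m') → Word (m + m')
deleteSeam m z = init (take (suc m) z) ++ tail (drop (suc m) z)

seam-++ : ∀ {m m'} (c : Word (suc m)) (c' : Word (suc m')) → seam m (c ++ c') ≡ last c xor head c'
seam-++ c c' = cong₂ (λ u v → last u xor head v) (take-++ c c') (drop-++ c c')

deleteSeam-++ : ∀ {m m'} (c : Word (suc m)) (c' : Word (suc m')) → deleteSeam m (c ++ c') ≡ init c ++ tail c'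
deleteSeam-++ c c' = cong₂ (λ u v → init u ++ tail v) (take-++ c c') (drop-++ c c')

seam-linear : ∀ m {m'} → IsLinearForm (seam m {m'})
seam-linear m x y = begin
  last (take (suc m) (x ⊕ y)) xor head (drop (suc m) (x ⊕ y))
    ≡⟨ cong₂ (λ u v → last u xor head v)
             (take-zipWith {m = suc m} _xor_ x y) (drop-zipWith {m = suc m} _xor_ x y) ⟩
  last (cx ⊕ cy) xor head (c'x ⊕ c'y)
    ≡⟨ cong₂ _xor_ (last-⊕ cx cy) (head-⊕ c'x c'y) ⟩
  (last cx xor last cy) xor (head c'x xor head c'y)
    ≡⟨ xor-interchange (last cx) (last cy) (head c'x) (head c'y) ⟩
  seam m x xor seam m y
    ∎
  where
    open ≡-Reasoning
    cx = take (suc m) x ; cy = take (suc m) y ; c'x = drop (suc m) x ; c'y = drop (suc m) y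

deleteSeam-linear : ∀ m {m'} → IsLinearMap (deleteSeam m {m'})
deleteSeam-linear m x y = begin
  init (take (suc m) (x ⊕ y)) ++ tail (drop (suc m) (x ⊕ y))
    ≡⟨ cong₂ (λ u v → init u ++ tail v)
             (take-zipWith {m = suc m} _xor_ x y) (drop-zipWith {m = suc m} _xor_ x y) ⟩
  init (cx ⊕ cy) ++ tail (c'x ⊕ c'y)
    ≡⟨ cong₂ _++_ (init-⊕ cx cy) (tail-⊕ c'x c'y) ⟩
  (init cx ⊕ init cy) ++ (tail c'x ⊕ tail c'y)
    ≡⟨ zipWith-++ _xor_ (init cx) (tail c'x) (init cy) (tail c'y) ⟨
  deleteSeam m x ⊕ deleteSeam m y
    ∎
  where
    open ≡-Reasoning
    cx = take (suc m) x ; cy = take (suc m) y ; c'x = drop (suc m) x ; c'y = drop (suc m) y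

module _ {m m' : ℕ} (C : Code (suc m)) (C' : Code (suc m')) where

  Glued : Code (suc m + suc m')
  Glued = (C ⊞ C') ∩ Ker (seam m)

  deleteSeam-into : ∀ z → Glued z → twoSum C C' (deleteSeam m z)
  deleteSeam-into z ((c∈C , c'∈C') , seam≡0) =
    take (suc m) z , drop (suc m) z , c∈C , c'∈C' , xor≡false⇒≡ _ _ seam≡0 , refl

  deleteSeam-onto : ∀ x → twoSum C C' x → ∃ λ z → Glued z × deleteSeam m z ≡ x
  deleteSeam-onto x (c , c' , c∈C , c'∈C' , last≡head , x≡) =
    c ++ c' ,
    ( (subst C (sym (take-++ c c')) c∈C , subst C' (sym (drop-++ c c')) c'∈C')
    , trans (seam-++ c c') (trans (cong (_xor head c') last≡head) (xor-same (head c'))) ) ,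
    trans (deleteSeam-++ c c') (sym x≡)

  deleteSeam-injective : ¬ C e-last → ∀ z → Glued z → deleteSeam m z ≡ zeros → z ≡ zeros
  deleteSeam-injective e-last∉C z ((c∈C , _) , seam≡0) e =
    trans (sym (take++drop≡id (suc m) z)) (trans (cong₂ _++_ c≡0 c'≡0) (zeros-++ (suc m)))
    where
      c = take (suc m) z
      c' = drop (suc m) z
      halves = ++-injective (init c) zeros (trans e (sym (zeros-++ m)))
      c≡0 : c ≡ zeros
      c≡0 with init≡zeros⇒ c (proj₁ halves)
      ... | inj₁ c≡0      = c≡0
      ... | inj₂ c≡e-last = ⊥-elim (e-last∉C (subst C c≡e-last c∈C))
      head-c'≡0 : head c' ≡ false
      head-c'≡0 = trans (sym (xor≡false⇒≡ _ _ seam≡0)) (trans (cong last c≡0) (last-zeros {m}))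
      c'≡0 : c' ≡ zeros
      c'≡0 with c' | head-c'≡0 | proj₂ halves
      ... | _ ∷ _ | h≡0 | t≡0 = cong₂ _∷_ h≡0 t≡0

  twoSum-linearIso : ¬ C e-last → ¬ (C ⊥) e-last → IsLinear C' →
                     {L : Word k → Word (suc m)} {L' : Word k' → Word (suc m')} →
                     LinearIso L C → LinearIso L' C' →
                     ∃ λ (M : Word (k + k' ∸ 1) → Word (m + m')) → LinearIso M (twoSum C C')
  twoSum-linearIso e-last∉C e-last∉C⊥ linC' isoL isoL' =
    let (G , isoG) = ∩Ker-linearIso (seam m) (seam-linear m) joined
                                    (nonzeroOn⇒image-witness (seam m) joined seam≢0)
    in deleteSeam m ∘ G ,
       ∘-linearIso isoG (deleteSeam-linear m) (deleteSeam-injective e-last∉C) deleteSeam-into deleteSeam-onto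
    where
      joined = ⊞-linearIso isoL isoL'
      seam≢0 : ¬ (∀ z → (C ⊞ C') z → seam m z ≡ false)
      seam≢0 seam≡0 = e-last∉C⊥ λ c c∈C → begin
        dot c e-last            ≡⟨ dot-e-last c ⟩
        last c                  ≡⟨ xor-identityʳ (last c) ⟨
        last c xor false        ≡⟨ seam-++ c (zeros {suc m'}) ⟨
        seam m (c ++ zeros)     ≡⟨ seam≡0 (c ++ zeros) ( subst C (sym (take-++ c zeros)) c∈C
                                                       , subst C' (sym (drop-++ c zeros)) (IsLinear.has-zero linC')) ⟩
        false                   ∎
        where open ≡-Reasoning

IsMinDist-≤ : {D : Code n} {E : Code n'} (f : Word n → Word n') →
              (∀ x → D x → E (f x)) → (∀ x → f x ≡ zeros → x ≡ zeros) →
              (∀ x → wt (f x) ≡ wt x) →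
              ∀ {d d'} → IsMinDist E d → IsMinDist D d' → d ≤ d'
IsMinDist-≤ f f-into f-injective f-wt {d} (_ , E-min) ((x , x∈D , x≢0 , wt-x≡d') , _) =
  subst (d ≤_) (trans (f-wt x) wt-x≡d') (E-min (f x) (f-into x x∈D) (x≢0 ∘ f-injective x))

module _ {m m' : ℕ} {C : Code (suc m)} {C' : Code (suc m')} where

  shortenLast-≤ : IsLinear C' → ∀ {d d₁} →
                  IsMinDist (twoSum C C') d → IsMinDist (shortenLast C) d₁ → d ≤ d₁
  shortenLast-≤ linC' = IsMinDist-≤ (_++ zeros) pad-into
    (λ x e → ++-injectiveˡ x zeros (trans e (sym (zeros-++ m))))
    (λ x → trans (wt-++ x zeros) (trans (cong (wt x +_) (wt-zeros {m'})) (+-identityʳ (wt x))))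
    where
      pad-into : ∀ x → shortenLast C x → twoSum C C' (x ++ zeros)
      pad-into x (c , c∈C , last≡0 , init≡x) =
        c , zeros , c∈C , IsLinear.has-zero linC' , last≡0 , cong (_++ zeros) (sym init≡x)

  shortenFirst-≤ : IsLinear C → ∀ {d d₂} →
                   IsMinDist (twoSum C C') d → IsMinDist (shortenFirst C') d₂ → d ≤ d₂
  shortenFirst-≤ linC = IsMinDist-≤ (zeros ++_) pad-into
    (λ x e → ++-injectiveʳ zeros zeros (trans e (sym (zeros-++ m))))
    (λ x → trans (wt-++ (zeros {m}) x) (cong (_+ wt x) (wt-zeros {m})))
    where
      pad-into : ∀ x → shortenFirst C' x → twoSum C C' (zeros ++ x)
      pad-into x (c' , c'∈C' , head≡0 , tail≡x) =
        zeros , c' , IsLinear.has-zero linC , c'∈C' , trans (last-zeros {m}) (sym head≡0) ,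
        cong₂ _++_ (sym (init-zeros {m})) (sym tail≡x)

proposition4p3 : (m m' : ℕ) → 2 ≤ m → 2 ≤ m' →
    (C : Code (suc m)) (C' : Code (suc m')) → IsLinear C → IsLinear C' →
    ¬ C e-last → ¬ (C ⊥) e-last → ¬ C' e-first → ¬ (C' ⊥) e-first →
    (∀ k k' → HasDim C k → HasDim C' k' → HasDim (twoSum C C') (k + k' ∸ 1)) ×
    (∀ d → IsMinDist (twoSum C C') d →
    (∀ d₁ → IsMinDist (shortenLast C) d₁ → d ≤ d₁) ×
    (∀ d₂ → IsMinDist (shortenFirst C') d₂ → d ≤ d₂))
proposition4p3 m m' _ _ C C' linC linC' e-last∉C e-last∉C⊥ _ _ =
  dimension , λ _ d-min → (λ _ → shortenLast-≤ linC' d-min) , (λ _ → shortenFirst-≤ linC d-min)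
  where
    dimension : ∀ k k' → HasDim C k → HasDim C' k' → HasDim (twoSum C C') (k + k' ∸ 1)
    dimension k k' dimC dimC' =
      let (L , isoL) = hasDim⇒linearIso linC dimC
          (L' , isoL') = hasDim⇒linearIso linC' dimC'
      in linearIso⇒hasDim (proj₂ (twoSum-linearIso C C' e-last∉C e-last∉C⊥ linC' isoL isoL'))
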